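{- Let $n$ and $e$ be positive integers. (i) If $n$ is odd, then $n-S_{e,!}(n)=(n-1)-S_{e,!}(n-1)$. (ii) If $n$ is even, then $n-S_{e,!}(n)=(n+1)-S_{e,!}(n+1)$.
   Context: Every positive integer $n$ has a unique factoradic (factorial base) representation $n=\sum_{i=1}^k a_i\cdot i!$ with $a_k\neq 0$ and $0\leq a_i\leq i$ for $1\leq i\leq k$. For an integer $e\geq 1$, the $e$-power factoradic happy function $S_{e,!}:\mathbb{Z}_{\geq 0}\to\mathbb{Z}_{\geq 0}$ is defined by $S_{e,!}(0)=0$ and $S_{e,!}(n)=\sum_{i=1}^k a_i^e$ for $n\geq 1$. -}

module Defs where

open import Data.Nat using (ℕ; zero; suc; _+_; _^_; _%_; _/_)
open import Data.List using (List; []; _∷_; map)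
open import Data.Nat.ListAction using (sum)

-- Factoradic digits of m, starting at position i (i.e. base i+1):
-- returns [a_i, a_{i+1}, ..., a_k] where m = Σ_{j≥i} a_j · j!/i! ... computed by
-- repeated division: a_i = m mod (i+1), continue with m / (i+1) at position i+1.
-- The fuel argument bounds the recursion (fuel = m suffices since the quotient
-- strictly decreases); recursion stops when the remaining value is 0, so no
-- trailing zero digits are produced (a_k ≠ 0).
factoradicFrom : (fuel : ℕ) → (i : ℕ) → (m : ℕ) → List ℕ
factoradicFrom zero    i m       = []
factoradicFrom (suc f) i zero    = []
factoradicFrom (suc f) i (suc m) =
  (suc m % suc (suc i)) ∷ factoradicFrom f (suc i) (suc m / suc (suc i))

-- factoradic n = [a_1, a_2, ..., a_k] with n = Σ a_i · i!, 0 ≤ a_i ≤ i, a_k ≠ 0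
-- (empty list for n = 0).  Position index starts at i = 1, i.e. base 2 first.
factoradic : ℕ → List ℕ
factoradic n = factoradicFrom n 0 n

S! : ℕ → ℕ → ℕ
S! e n = sum (map (λ a → a ^ e) (factoradic n))

open import Relation.Binary.PropositionalEquality using (_≡_; refl)
_ : factoradic 23 ≡ 1 ∷ 2 ∷ 3 ∷ []
_ = refl
_ : factoradic 24 ≡ 0 ∷ 0 ∷ 0 ∷ 1 ∷ []
_ = refl
_ : factoradic 5 ≡ 1 ∷ 2 ∷ []
_ = refl

{-# OPTIONS --safe #-}
-- The first factoradic digit of n is n mod 2 and the remaining digits are those
-- of ⌊n/2⌋ read from position 2 on.  Hence 2k and 2k+1 share all digits except
-- the first, which is 0 resp. 1, so S_{e,!}(2k+1) = 1 + S_{e,!}(2k) for e ≥ 1: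
-- both n and S_{e,!}(n) grow by one from 2k to 2k+1, and n − S_{e,!}(n) is unchanged.
module Submission where

open import Defs
open import Data.Nat using (ℕ; zero; suc; _≥_; _∸_; _%_; _/_; _+_; _*_; _^_; _≤_; _<_; s≤s; z≤n)
open import Data.Nat.Properties using (≤-refl; ≤-trans; ^-zeroˡ)
open import Data.Nat.DivMod using (m/n<m; m*n/n≡m; m*n%n≡0; [m+kn]%n≡m%n; +-distrib-/; m≡m%n+[m/n]*n)
open import Data.Nat.ListAction using (sum)
open import Data.List using (List; _∷_; map)
open import Data.Integer using (ℤ; +_; _-_)
open import Data.Integer.Properties using (m-n≡m⊖n; [1+m]⊖[1+n]≡m⊖n)
open import Data.Product using (_×_; _,_)
open import Relation.Binary.PropositionalEquality using (_≡_; refl; sym; trans; cong; cong₂; subst; module ≡-Reasoning)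
open ≡-Reasoning

[1+m]/[2+i]≤m : ∀ m i → suc m / suc (suc i) ≤ m
[1+m]/[2+i]≤m m i with m/n<m (suc m) (suc (suc i)) (s≤s (s≤s z≤n))
... | s≤s q≤m = q≤m

factoradicFrom-fuel : ∀ {f g} i m → m ≤ f → m ≤ g → factoradicFrom f i m ≡ factoradicFrom g i m
factoradicFrom-fuel {zero}  {zero}  i zero    _         _         = refl
factoradicFrom-fuel {zero}  {suc _} i zero    _         _         = refl
factoradicFrom-fuel {suc _} {zero}  i zero    _         _         = refl
factoradicFrom-fuel {suc _} {suc _} i zero    _         _         = refl
factoradicFrom-fuel {suc _} {suc _} i (suc m) (s≤s m≤f) (s≤s m≤g) =
  cong (suc m % suc (suc i) ∷_)
       (factoradicFrom-fuel (suc i) (suc m / suc (suc i))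
                            (≤-trans ([1+m]/[2+i]≤m m i) m≤f) (≤-trans ([1+m]/[2+i]≤m m i) m≤g))

-- The factoradic digits a₂, a₃, … of a number whose quotient by 2 is q.
tailDigits : ℕ → List ℕ
tailDigits q = factoradicFrom q 1 q

factoradic-suc : ∀ m → factoradic (suc m) ≡ suc m % 2 ∷ tailDigits (suc m / 2)
factoradic-suc m =
  cong (suc m % 2 ∷_) (factoradicFrom-fuel 1 (suc m / 2) ([1+m]/[2+i]≤m m 0) ≤-refl)

[1+2k]%2≡1 : ∀ k → suc (k * 2) % 2 ≡ 1
[1+2k]%2≡1 k = [m+kn]%n≡m%n 1 k 2

[1+2k]/2≡k : ∀ k → suc (k * 2) / 2 ≡ k
[1+2k]/2≡k k = trans (+-distrib-/ 1 (k * 2) carry-free) (m*n/n≡m k 2)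
  where
  carry-free : 1 % 2 + k * 2 % 2 < 2
  carry-free = subst (λ r → 1 + r < 2) (sym (m*n%n≡0 k 2)) ≤-refl

factoradic-odd : ∀ k → factoradic (suc (k * 2)) ≡ 1 ∷ tailDigits k
factoradic-odd k =
  trans (factoradic-suc (k * 2)) (cong₂ (λ a q → a ∷ tailDigits q) ([1+2k]%2≡1 k) ([1+2k]/2≡k k))

factoradic-even : ∀ k → factoradic (suc k * 2) ≡ 0 ∷ tailDigits (suc k)
factoradic-even k =
  trans (factoradic-suc (suc (k * 2)))
        (cong₂ (λ a q → a ∷ tailDigits q) (m*n%n≡0 (suc k) 2) (m*n/n≡m (suc k) 2))

powerSum : ℕ → List ℕ → ℕ
powerSum e ds = sum (map (λ a → a ^ e) ds)

S!-odd : ∀ e k → S! e (suc (k * 2)) ≡ 1 + powerSum e (tailDigits k)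
S!-odd e k = begin
  S! e (suc (k * 2))               ≡⟨ cong (powerSum e) (factoradic-odd k) ⟩
  1 ^ e + powerSum e (tailDigits k) ≡⟨ cong (_+ powerSum e (tailDigits k)) (^-zeroˡ e) ⟩
  1 + powerSum e (tailDigits k)     ∎

-- The leading digit 0 contributes 0 ^ e, which vanishes only for e ≥ 1.
S!-even : ∀ e k → e ≥ 1 → S! e (k * 2) ≡ powerSum e (tailDigits k)
S!-even (suc e) zero    _ = refl
S!-even (suc e) (suc k) _ = cong (powerSum (suc e)) (factoradic-even k)

S!-odd≡1+S!-even : ∀ e k → e ≥ 1 → S! e (suc (k * 2)) ≡ suc (S! e (k * 2))
S!-odd≡1+S!-even e k e≥1 = trans (S!-odd e k) (cong suc (sym (S!-even e k e≥1)))

excess : ℕ → ℕ → ℤ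
excess e n = + n - + S! e n

+[1+m]-+[1+n]≡+m-+n : ∀ m n → + suc m - + suc n ≡ + m - + n
+[1+m]-+[1+n]≡+m-+n m n = trans ([1+m]⊖[1+n]≡m⊖n m n) (sym (m-n≡m⊖n m n))

excess-odd≡excess-even : ∀ e k → e ≥ 1 → excess e (suc (k * 2)) ≡ excess e (k * 2)
excess-odd≡excess-even e k e≥1 = begin
  + suc (k * 2) - + S! e (suc (k * 2))   ≡⟨ cong (λ s → + suc (k * 2) - + s) (S!-odd≡1+S!-even e k e≥1) ⟩
  + suc (k * 2) - + suc (S! e (k * 2))   ≡⟨ +[1+m]-+[1+n]≡+m-+n (k * 2) (S! e (k * 2)) ⟩
  + (k * 2) - + S! e (k * 2)             ∎

lemma2p1 : (n e : ℕ) → n ≥ 1 → e ≥ 1 →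
    (n % 2 ≡ 1 → (+ n) - (+ S! e n) ≡ (+ (n ∸ 1)) - (+ S! e (n ∸ 1)))
    × (n % 2 ≡ 0 → (+ n) - (+ S! e n) ≡ (+ suc n) - (+ S! e (suc n)))
lemma2p1 n e _ e≥1 = odd , even
  where
  k = n / 2
  n≡r+2k : ∀ {r} → n % 2 ≡ r → n ≡ r + k * 2
  n≡r+2k n%2≡r = trans (m≡m%n+[m/n]*n n 2) (cong (_+ k * 2) n%2≡r)
  odd : n % 2 ≡ 1 → excess e n ≡ excess e (n ∸ 1)
  odd n%2≡1 = subst (λ m → excess e m ≡ excess e (m ∸ 1))
                    (sym (n≡r+2k n%2≡1)) (excess-odd≡excess-even e k e≥1)
  even : n % 2 ≡ 0 → excess e n ≡ excess e (suc n)
  even n%2≡0 = subst (λ m → excess e m ≡ excess e (suc m))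
                     (sym (n≡r+2k n%2≡0)) (sym (excess-odd≡excess-even e k e≥1))
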